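{- Let $A_0,\dots,A_n$ be subalgebras of a Boolean algebra $B$ such that (1) $(A_i)_{i<n}$ commutes in $B$; (2) $A_n\cap\langle\bigcup_{i<n}A_i\rangle=\langle A_n\cap\bigcup_{i<n}A_i\rangle$; and (3) the pair $\big(\langle\bigcup_{i<n}A_i\rangle,A_n\big)$ commutes in $B$. Then $(A_i)_{i<n+1}$ commutes in $B$.
   Context: $\langle S\rangle$ is the subalgebra generated by $S$. Given subalgebras $C_0,\dots,C_{k-1}$ of $B$, let $P$ be the quotient of the free product $\bigoplus_{i<k}C_i$ (cofactor maps $\iota_i$) by the ideal generated by all $\iota_i(z)\wedge\iota_j(-z)$ with $z\in C_i\cap C_j$; $(C_i)_{i<k}$ commutes in $B$ if the unique homomorphism $P\to B$ extending the inclusions $C_i\to B$ is injective. -}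

module Defs where

open import Level using (Level; _⊔_)
open import Data.Nat using (ℕ)
open import Data.Fin using (Fin; zero; suc)
open import Data.Product using (∃)
open import Relation.Unary using (Pred)
open import Algebra.Lattice.Bundles using (BooleanAlgebra)

module _ {c ℓ : Level} (B : BooleanAlgebra c ℓ) where
  open BooleanAlgebra B using (Carrier; _≈_; _∧_; _∨_; ¬_; ⊤; ⊥)

  Subset : Set _
  Subset = Pred Carrier (c ⊔ ℓ)

  record IsSubalgebra (A : Subset) : Set (c ⊔ ℓ) where
    field
      ≈-closed : ∀ {x y} → x ≈ y → A x → A y
      ⊤-closed : A ⊤
      ⊥-closed : A ⊥
      ∧-closed : ∀ {x y} → A x → A y → A (x ∧ y)
      ∨-closed : ∀ {x y} → A x → A y → A (x ∨ y)
      ¬-closed : ∀ {x} → A x → A (¬ x)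

  data ⟨_⟩ (S : Subset) : Subset where
    base : ∀ {x} → S x → ⟨ S ⟩ x
    resp : ∀ {x y} → x ≈ y → ⟨ S ⟩ x → ⟨ S ⟩ y
    ⊤-gen : ⟨ S ⟩ ⊤
    ⊥-gen : ⟨ S ⟩ ⊥
    ∧-gen : ∀ {x y} → ⟨ S ⟩ x → ⟨ S ⟩ y → ⟨ S ⟩ (x ∧ y)
    ∨-gen : ∀ {x y} → ⟨ S ⟩ x → ⟨ S ⟩ y → ⟨ S ⟩ (x ∨ y)
    ¬-gen : ∀ {x} → ⟨ S ⟩ x → ⟨ S ⟩ (¬ x)

  ⋃ : ∀ {k} → (Fin k → Subset) → Subset
  ⋃ C x = ∃ λ i → C i x

  pair : Subset → Subset → Fin 2 → Subset
  pair X Y zero = X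
  pair X Y (suc _) = Y

  module FreeProduct {k : ℕ} (C : Fin k → Subset) where

    infixr 7 _∧ₜ_
    infixr 6 _∨ₜ_
    infix 4 _~_

    data Term : Set (c ⊔ ℓ) where
      gen  : (i : Fin k) (a : Carrier) → C i a → Term
      _∧ₜ_ : Term → Term → Term
      _∨ₜ_ : Term → Term → Term
      ¬ₜ   : Term → Term
      ⊤ₜ   : Term
      ⊥ₜ   : Term

    -- The least congruence on terms such that:
    --  * terms modulo it form a Boolean algebra (axioms of IsBooleanAlgebra),
    --  * each cofactor map ι_i : C_i → ⊕ C_i is a Boolean homomorphism
    --    (so Term/~ without the last clause is the free product ⊕_{i<k} C_i),
    --  * every generator ι_i(z) ∧ ι_j(-z) (z ∈ C_i ∩ C_j) of the ideal is
    --    identified with ⊥ (quotient by the generated ideal).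
    -- Hence Term/~ is exactly P.
    data _~_ : Term → Term → Set (c ⊔ ℓ) where
      ~-refl  : ∀ {t} → t ~ t
      ~-sym   : ∀ {t s} → t ~ s → s ~ t
      ~-trans : ∀ {t s u} → t ~ s → s ~ u → t ~ u
      ∧-congₜ  : ∀ {t t′ s s′} → t ~ t′ → s ~ s′ → t ∧ₜ s ~ t′ ∧ₜ s′
      ∨-congₜ  : ∀ {t t′ s s′} → t ~ t′ → s ~ s′ → t ∨ₜ s ~ t′ ∨ₜ s′
      ¬-congₜ  : ∀ {t t′} → t ~ t′ → ¬ₜ t ~ ¬ₜ t′
      ∨-commₜ  : ∀ t s → t ∨ₜ s ~ s ∨ₜ t
      ∨-assocₜ : ∀ t s u → (t ∨ₜ s) ∨ₜ u ~ t ∨ₜ (s ∨ₜ u)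
      ∧-commₜ  : ∀ t s → t ∧ₜ s ~ s ∧ₜ t
      ∧-assocₜ : ∀ t s u → (t ∧ₜ s) ∧ₜ u ~ t ∧ₜ (s ∧ₜ u)
      ∨-absorbs-∧ₜ : ∀ t s → t ∨ₜ (t ∧ₜ s) ~ t
      ∧-absorbs-∨ₜ : ∀ t s → t ∧ₜ (t ∨ₜ s) ~ t
      ∨-distribˡ-∧ₜ : ∀ t s u → t ∨ₜ (s ∧ₜ u) ~ (t ∨ₜ s) ∧ₜ (t ∨ₜ u)
      ∨-distribʳ-∧ₜ : ∀ t s u → (s ∧ₜ u) ∨ₜ t ~ (s ∨ₜ t) ∧ₜ (u ∨ₜ t)
      ∧-distribˡ-∨ₜ : ∀ t s u → t ∧ₜ (s ∨ₜ u) ~ (t ∧ₜ s) ∨ₜ (t ∧ₜ u)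
      ∧-distribʳ-∨ₜ : ∀ t s u → (s ∨ₜ u) ∧ₜ t ~ (s ∧ₜ t) ∨ₜ (u ∧ₜ t)
      ∨-complementˡₜ : ∀ t → ¬ₜ t ∨ₜ t ~ ⊤ₜ
      ∨-complementʳₜ : ∀ t → t ∨ₜ ¬ₜ t ~ ⊤ₜ
      ∧-complementˡₜ : ∀ t → ¬ₜ t ∧ₜ t ~ ⊥ₜ
      ∧-complementʳₜ : ∀ t → t ∧ₜ ¬ₜ t ~ ⊥ₜ
      ι-≈ : ∀ {i a b} (pa : C i a) (pb : C i b) → a ≈ b → gen i a pa ~ gen i b pb
      ι-∧ : ∀ {i a b} (pab : C i (a ∧ b)) (pa : C i a) (pb : C i b) →
            gen i (a ∧ b) pab ~ gen i a pa ∧ₜ gen i b pb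
      ι-∨ : ∀ {i a b} (pab : C i (a ∨ b)) (pa : C i a) (pb : C i b) →
            gen i (a ∨ b) pab ~ gen i a pa ∨ₜ gen i b pb
      ι-¬ : ∀ {i a} (pna : C i (¬ a)) (pa : C i a) → gen i (¬ a) pna ~ ¬ₜ (gen i a pa)
      ι-⊤ : ∀ {i} (p : C i ⊤) → gen i ⊤ p ~ ⊤ₜ
      ι-⊥ : ∀ {i} (p : C i ⊥) → gen i ⊥ p ~ ⊥ₜ
      ideal : ∀ {i j z} (pi : C i z) (pj : C j z) →
              gen i z pi ∧ₜ ¬ₜ (gen j z pj) ~ ⊥ₜ

    eval : Term → Carrier
    eval (gen i a _) = a
    eval (t ∧ₜ s) = eval t ∧ eval s
    eval (t ∨ₜ s) = eval t ∨ eval s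
    eval (¬ₜ t) = ¬ eval t
    eval ⊤ₜ = ⊤
    eval ⊥ₜ = ⊥

  Commutes : ∀ {k} → (Fin k → Subset) → Set (c ⊔ ℓ)
  Commutes C = ∀ t s → eval t ≈ eval s → t ~ s
    where open FreeProduct C

-- Write D = ⟨⋃_{i<n} A_i⟩ and P_k for the free product of A_0,…,A_{k-1} modulo the
-- ideal. Regrouping the generators gives a map P_{n+1} → P(D, A_n) over B, and
-- P(D, A_n) → B is injective by (3). Conversely, a generator d ∈ D is sent to a
-- term of P_n representing it, which is well defined because P_n → B is injective
-- by (1); this yields a map back P(D, A_n) → P_{n+1}. The only relations of
-- P(D, A_n) not visibly respected are the ideal generators ι_D(d) ∧ ι_{A_n}(-d) with
-- d ∈ D ∩ A_n, and these are handled by (2): such d is built from elements of A_n ∩ A_i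
-- (i < n), each of which is identified with its A_n-copy in P_{n+1}. The second
-- map is a left inverse of the first, so P_{n+1} → B is injective.
module Submission where

open import Defs
open import Level using (_⊔_)
open import Data.Nat using (ℕ; suc)
open import Data.Fin using (Fin; zero; suc; inject₁; fromℕ)
open import Data.Fin.Relation.Unary.Top using (view; ‵fromℕ; ‵inj₁)
open import Data.Product using (_,_; proj₁; proj₂)
open import Function using (_∘_; id)
open import Relation.Unary using (_∩_; _≐_; _⊆_)
open import Relation.Binary.Bundles using (Setoid)
open import Algebra.Lattice.Bundles using (BooleanAlgebra)
import Relation.Binary.Reasoning.Setoid as SetoidReasoning

module _ {c ℓ} (B : BooleanAlgebra c ℓ) where
  open BooleanAlgebra B

  ⟨⟩-least : ∀ {S A : Subset B} → IsSubalgebra B A → S ⊆ A → ⟨_⟩ B S ⊆ A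
  ⟨⟩-least {A = A} subA S⊆A = go
    where
    open IsSubalgebra subA
    go : ⟨_⟩ B _ ⊆ A
    go (base s)    = S⊆A s
    go (resp e p)  = ≈-closed e (go p)
    go ⊤-gen       = ⊤-closed
    go ⊥-gen       = ⊥-closed
    go (∧-gen p q) = ∧-closed (go p) (go q)
    go (∨-gen p q) = ∨-closed (go p) (go q)
    go (¬-gen p)   = ¬-closed (go p)

  module _ {k} {C : Fin k → Subset B} where
    open FreeProduct B C

    termSetoid : Setoid (c ⊔ ℓ) (c ⊔ ℓ)
    termSetoid = record
      { Carrier = Term
      ; _≈_ = _~_
      ; isEquivalence = record { refl = ~-refl ; sym = ~-sym ; trans = ~-trans }
      }

    ~⇒∧¬~⊥ : ∀ {t s} → t ~ s → t ∧ₜ ¬ₜ s ~ ⊥ₜ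
    ~⇒∧¬~⊥ {s = s} t~s = ~-trans (∧-congₜ t~s ~-refl) (∧-complementʳₜ s)

    ∧¬~⊥⇒~∧ : ∀ t s → t ∧ₜ ¬ₜ s ~ ⊥ₜ → t ~ t ∧ₜ s
    ∧¬~⊥⇒~∧ t s t∧¬s~⊥ = begin
      t                          ≈⟨ ∧-absorbs-∨ₜ t (¬ₜ t) ⟨
      t ∧ₜ (t ∨ₜ ¬ₜ t)           ≈⟨ ∧-congₜ ~-refl (∨-complementʳₜ t) ⟩
      t ∧ₜ ⊤ₜ                    ≈⟨ ∧-congₜ ~-refl (∨-complementʳₜ s) ⟨
      t ∧ₜ (s ∨ₜ ¬ₜ s)           ≈⟨ ∧-distribˡ-∨ₜ t s (¬ₜ s) ⟩
      t ∧ₜ s ∨ₜ t ∧ₜ ¬ₜ s        ≈⟨ ∨-congₜ ~-refl t∧¬s~⊥ ⟩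
      t ∧ₜ s ∨ₜ ⊥ₜ               ≈⟨ ∨-congₜ ~-refl (∧-complementʳₜ u) ⟨
      u ∨ₜ u ∧ₜ ¬ₜ u             ≈⟨ ∨-absorbs-∧ₜ u (¬ₜ u) ⟩
      t ∧ₜ s                     ∎
      where
      open SetoidReasoning termSetoid
      u = t ∧ₜ s

    ∧¬~⊥-antisym : ∀ {t s} → t ∧ₜ ¬ₜ s ~ ⊥ₜ → s ∧ₜ ¬ₜ t ~ ⊥ₜ → t ~ s
    ∧¬~⊥-antisym {t} {s} t≤s s≤t =
      ~-trans (∧¬~⊥⇒~∧ t s t≤s)
        (~-trans (∧-commₜ t s) (~-sym (∧¬~⊥⇒~∧ s t s≤t)))

    gen-shared : ∀ {i j z} (pi : C i z) (pj : C j z) → gen i z pi ~ gen j z pj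
    gen-shared pi pj = ∧¬~⊥-antisym (ideal pi pj) (ideal pj pi)

    represent : ∀ {S : Subset B} → S ⊆ ⋃ B C → ∀ {x} → ⟨_⟩ B S x → Term
    represent S⊆⋃C {x} (base s) = gen (proj₁ (S⊆⋃C s)) x (proj₂ (S⊆⋃C s))
    represent S⊆⋃C (resp _ p)  = represent S⊆⋃C p
    represent S⊆⋃C ⊤-gen       = ⊤ₜ
    represent S⊆⋃C ⊥-gen       = ⊥ₜ
    represent S⊆⋃C (∧-gen p q) = represent S⊆⋃C p ∧ₜ represent S⊆⋃C q
    represent S⊆⋃C (∨-gen p q) = represent S⊆⋃C p ∨ₜ represent S⊆⋃C q
    represent S⊆⋃C (¬-gen p)   = ¬ₜ (represent S⊆⋃C p)

    eval-represent : ∀ {S} (S⊆⋃C : S ⊆ ⋃ B C) {x} (p : ⟨_⟩ B S x) →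
                     eval (represent S⊆⋃C p) ≈ x
    eval-represent S⊆⋃C (base _)    = refl
    eval-represent S⊆⋃C (resp e p)  = trans (eval-represent S⊆⋃C p) e
    eval-represent S⊆⋃C ⊤-gen       = refl
    eval-represent S⊆⋃C ⊥-gen       = refl
    eval-represent S⊆⋃C (∧-gen p q) =
      ∧-cong (eval-represent S⊆⋃C p) (eval-represent S⊆⋃C q)
    eval-represent S⊆⋃C (∨-gen p q) =
      ∨-cong (eval-represent S⊆⋃C p) (eval-represent S⊆⋃C q)
    eval-represent S⊆⋃C (¬-gen p)   = ¬-cong (eval-represent S⊆⋃C p)

  module Extension {k m} (C : Fin k → Subset B) (C′ : Fin m → Subset B) where
    private
      module S = FreeProduct B C
      module T = FreeProduct B C′
    open T using (_~_; _∧ₜ_; _∨ₜ_; ¬ₜ; ⊤ₜ; ⊥ₜ)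

    Assignment : Set (c ⊔ ℓ)
    Assignment = ∀ i a → C i a → T.Term

    extend : Assignment → S.Term → T.Term
    extend g (S.gen i a p) = g i a p
    extend g (t S.∧ₜ s)    = extend g t ∧ₜ extend g s
    extend g (t S.∨ₜ s)    = extend g t ∨ₜ extend g s
    extend g (S.¬ₜ t)      = ¬ₜ (extend g t)
    extend g S.⊤ₜ          = ⊤ₜ
    extend g S.⊥ₜ          = ⊥ₜ

    record PreservesRelations (g : Assignment) : Set (c ⊔ ℓ) where
      field
        ≈-resp : ∀ {i a b} (pa : C i a) (pb : C i b) → a ≈ b → g i a pa ~ g i b pb
        ∧-hom  : ∀ {i a b} (pab : C i (a ∧ b)) (pa : C i a) (pb : C i b) →
                 g i (a ∧ b) pab ~ g i a pa ∧ₜ g i b pb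
        ∨-hom  : ∀ {i a b} (pab : C i (a ∨ b)) (pa : C i a) (pb : C i b) →
                 g i (a ∨ b) pab ~ g i a pa ∨ₜ g i b pb
        ¬-hom  : ∀ {i a} (pna : C i (¬ a)) (pa : C i a) → g i (¬ a) pna ~ ¬ₜ (g i a pa)
        ⊤-hom  : ∀ {i} (p : C i ⊤) → g i ⊤ p ~ ⊤ₜ
        ⊥-hom  : ∀ {i} (p : C i ⊥) → g i ⊥ p ~ ⊥ₜ
        ideal-resp : ∀ {i j z} (pi : C i z) (pj : C j z) →
                     g i z pi ∧ₜ ¬ₜ (g j z pj) ~ ⊥ₜ

    extend-cong : ∀ {g} → PreservesRelations g →
                  ∀ {t s} → t S.~ s → extend g t ~ extend g s
    extend-cong {g} hom = go
      where
      open PreservesRelations hom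
      go : ∀ {t s} → t S.~ s → extend g t ~ extend g s
      go S.~-refl                    = T.~-refl
      go (S.~-sym p)                 = T.~-sym (go p)
      go (S.~-trans p q)             = T.~-trans (go p) (go q)
      go (S.∧-congₜ p q)             = T.∧-congₜ (go p) (go q)
      go (S.∨-congₜ p q)             = T.∨-congₜ (go p) (go q)
      go (S.¬-congₜ p)               = T.¬-congₜ (go p)
      go (S.∨-commₜ t s)             = T.∨-commₜ _ _
      go (S.∨-assocₜ t s u)          = T.∨-assocₜ _ _ _
      go (S.∧-commₜ t s)             = T.∧-commₜ _ _
      go (S.∧-assocₜ t s u)          = T.∧-assocₜ _ _ _
      go (S.∨-absorbs-∧ₜ t s)        = T.∨-absorbs-∧ₜ _ _
      go (S.∧-absorbs-∨ₜ t s)        = T.∧-absorbs-∨ₜ _ _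
      go (S.∨-distribˡ-∧ₜ t s u)     = T.∨-distribˡ-∧ₜ _ _ _
      go (S.∨-distribʳ-∧ₜ t s u)     = T.∨-distribʳ-∧ₜ _ _ _
      go (S.∧-distribˡ-∨ₜ t s u)     = T.∧-distribˡ-∨ₜ _ _ _
      go (S.∧-distribʳ-∨ₜ t s u)     = T.∧-distribʳ-∨ₜ _ _ _
      go (S.∨-complementˡₜ t)        = T.∨-complementˡₜ _
      go (S.∨-complementʳₜ t)        = T.∨-complementʳₜ _
      go (S.∧-complementˡₜ t)        = T.∧-complementˡₜ _
      go (S.∧-complementʳₜ t)        = T.∧-complementʳₜ _
      go (S.ι-≈ pa pb e)             = ≈-resp pa pb e
      go (S.ι-∧ pab pa pb)           = ∧-hom pab pa pb
      go (S.ι-∨ pab pa pb)           = ∨-hom pab pa pb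
      go (S.ι-¬ pna pa)              = ¬-hom pna pa
      go (S.ι-⊤ p)                   = ⊤-hom p
      go (S.ι-⊥ p)                   = ⊥-hom p
      go (S.ideal pi pj)             = ideal-resp pi pj

    eval-extend : ∀ {g} → (∀ i a p → T.eval (g i a p) ≈ a) →
                  ∀ t → T.eval (extend g t) ≈ S.eval t
    eval-extend g-eval (S.gen i a p) = g-eval i a p
    eval-extend g-eval (t S.∧ₜ s)    = ∧-cong (eval-extend g-eval t) (eval-extend g-eval s)
    eval-extend g-eval (t S.∨ₜ s)    = ∨-cong (eval-extend g-eval t) (eval-extend g-eval s)
    eval-extend g-eval (S.¬ₜ t)      = ¬-cong (eval-extend g-eval t)
    eval-extend g-eval S.⊤ₜ          = refl
    eval-extend g-eval S.⊥ₜ          = refl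

    extend-represent~gen : ∀ {g j} {S : Subset B} → IsSubalgebra B (C′ j) → S ⊆ C′ j →
      (S⊆⋃C : S ⊆ ⋃ B C) → PreservesRelations g →
      (∀ {i x} (p : C i x) (pj : C′ j x) → g i x p ~ T.gen j x pj) →
      ∀ {z} (q : ⟨_⟩ B S z) (pz : C′ j z) → extend g (represent S⊆⋃C q) ~ T.gen j z pz
    extend-represent~gen {g} {j} subC′j S⊆C′j S⊆⋃C hom g~gen = go
      where
      open PreservesRelations hom
      ⟨S⟩⊆C′j = ⟨⟩-least subC′j S⊆C′j
      go : ∀ {z} (q : ⟨_⟩ B _ z) (pz : C′ j z) → extend g (represent S⊆⋃C q) ~ T.gen j z pz
      go′ : ∀ {z} (q : ⟨_⟩ B _ z) → extend g (represent S⊆⋃C q) ~ T.gen j z (⟨S⟩⊆C′j q)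
      go′ q = go q (⟨S⟩⊆C′j q)
      go (base s)    pz = g~gen (proj₂ (S⊆⋃C s)) pz
      go (resp e q)  pz = T.~-trans (go′ q) (T.ι-≈ (⟨S⟩⊆C′j q) pz e)
      go ⊤-gen       pz = T.~-sym (T.ι-⊤ pz)
      go ⊥-gen       pz = T.~-sym (T.ι-⊥ pz)
      go (∧-gen p q) pz = T.~-trans (T.∧-congₜ (go′ p) (go′ q))
                                    (T.~-sym (T.ι-∧ pz (⟨S⟩⊆C′j p) (⟨S⟩⊆C′j q)))
      go (∨-gen p q) pz = T.~-trans (T.∨-congₜ (go′ p) (go′ q))
                                    (T.~-sym (T.ι-∨ pz (⟨S⟩⊆C′j p) (⟨S⟩⊆C′j q)))
      go (¬-gen p)   pz = T.~-trans (T.¬-congₜ (go′ p)) (T.~-sym (T.ι-¬ pz (⟨S⟩⊆C′j p)))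

  module _ {k m} {C : Fin m → Subset B} (σ : Fin k → Fin m) where
    open FreeProduct B C
    open Extension (C ∘ σ) C

    reindex : Assignment
    reindex i = gen (σ i)

    reindex-preserves : PreservesRelations reindex
    reindex-preserves = record
      { ≈-resp = ι-≈ ; ∧-hom = ι-∧ ; ∨-hom = ι-∨ ; ¬-hom = ι-¬ ; ⊤-hom = ι-⊤ ; ⊥-hom = ι-⊥
      ; ideal-resp = ideal
      }

  module _ {k m} {C : Fin k → Subset B} {C′ : Fin m → Subset B} where
    private
      module S = FreeProduct B C
      module T = FreeProduct B C′
      module E = Extension C C′
      module E′ = Extension C′ C

    retract-commutes : (g : E.Assignment) (h : E′.Assignment) →
      (∀ i a p → T.eval (g i a p) ≈ a) → E′.PreservesRelations h →
      (∀ i a p → E′.extend h (g i a p) S.~ S.gen i a p) →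
      Commutes B C′ → Commutes B C
    retract-commutes g h g-eval h-hom hg~gen C′-commutes t s e =
      S.~-trans (S.~-sym (hg~id t))
        (S.~-trans (E′.extend-cong h-hom (C′-commutes (E.extend g t) (E.extend g s) ge≈ge))
          (hg~id s))
      where
      ge≈ge : T.eval (E.extend g t) ≈ T.eval (E.extend g s)
      ge≈ge = trans (E.eval-extend g-eval t) (trans e (sym (E.eval-extend g-eval s)))
      hg~id : ∀ t → E′.extend h (E.extend g t) S.~ t
      hg~id (S.gen i a p) = hg~gen i a p
      hg~id (t S.∧ₜ s)    = S.∧-congₜ (hg~id t) (hg~id s)
      hg~id (t S.∨ₜ s)    = S.∨-congₜ (hg~id t) (hg~id s)
      hg~id (S.¬ₜ t)      = S.¬-congₜ (hg~id t)
      hg~id S.⊤ₜ          = S.~-refl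
      hg~id S.⊥ₜ          = S.~-refl

  module _ {n} (A : Fin (suc n) → Subset B) where
    private
      Initial   = A ∘ inject₁
      Last      = A (fromℕ n)
      Generated = ⟨_⟩ B (⋃ B Initial)
      module P  = FreeProduct B A
      module Pₙ = FreeProduct B Initial
      module Q  = FreeProduct B (pair B Generated Last)
      module E  = Extension A (pair B Generated Last)
      module E′ = Extension (pair B Generated Last) A
      module L  = Extension Initial A
    open P using (_~_; _∧ₜ_; _∨ₜ_; ¬ₜ; ⊤ₜ; ⊥ₜ; gen)

    embed : Pₙ.Term → P.Term
    embed = L.extend (reindex inject₁)

    split : E.Assignment
    split i a p with view i
    ... | ‵fromℕ          = Q.gen (suc zero) a p
    ... | ‵inj₁ {i = j} _ = Q.gen zero a (base (j , p))

    merge : E′.Assignment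
    merge zero    a p = embed (represent id p)
    merge (suc _) a p = gen (fromℕ n) a p

    eval-split : ∀ i a p → Q.eval (split i a p) ≈ a
    eval-split i a p with view i
    ... | ‵fromℕ   = refl
    ... | ‵inj₁ _  = refl

    merge-split : ∀ i a p → E′.extend merge (split i a p) ~ gen i a p
    merge-split i a p with view i
    ... | ‵fromℕ   = P.~-refl
    ... | ‵inj₁ _  = P.~-refl

    merge-preserves : IsSubalgebra B Last → Commutes B Initial →
      Last ∩ Generated ⊆ ⟨_⟩ B (Last ∩ ⋃ B Initial) → E′.PreservesRelations merge
    merge-preserves subLast Initial-commutes Last∩Generated⊆ = record
      { ≈-resp = ≈-resp ; ∧-hom = ∧-hom ; ∨-hom = ∨-hom ; ¬-hom = ¬-hom
      ; ⊤-hom = ⊤-hom ; ⊥-hom = ⊥-hom ; ideal-resp = ideal-resp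
      }
      where
      rep : ∀ {x} → Generated x → Pₙ.Term
      rep = represent id

      ev : ∀ {x} (p : Generated x) → Pₙ.eval (rep p) ≈ x
      ev = eval-represent id

      embed-by-value : ∀ u v → Pₙ.eval u ≈ Pₙ.eval v → embed u ~ embed v
      embed-by-value u v e =
        L.extend-cong (reindex-preserves inject₁) (Initial-commutes u v e)

      rep~gen : ∀ {z} (p : Generated z) (pz : Last z) → embed (rep p) ~ gen (fromℕ n) z pz
      rep~gen p pz = P.~-trans
        (embed-by-value (rep p) (represent proj₂ q) (trans (ev p) (sym (eval-represent proj₂ q))))
        (L.extend-represent~gen subLast proj₁ proj₂ (reindex-preserves inject₁) gen-shared q pz)
        where
        q = Last∩Generated⊆ (pz , p)

      ≈-resp : ∀ {i a b} (pa : pair B Generated Last i a) (pb : pair B Generated Last i b) →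
               a ≈ b → merge i a pa ~ merge i b pb
      ≈-resp {zero}  pa pb e =
        embed-by-value (rep pa) (rep pb) (trans (ev pa) (trans e (sym (ev pb))))
      ≈-resp {suc _} pa pb e = P.ι-≈ pa pb e

      ∧-hom : ∀ {i a b} pab pa pb → merge i (a ∧ b) pab ~ merge i a pa ∧ₜ merge i b pb
      ∧-hom {zero}  pab pa pb = embed-by-value (rep pab) (rep pa Pₙ.∧ₜ rep pb)
        (trans (ev pab) (sym (∧-cong (ev pa) (ev pb))))
      ∧-hom {suc _} pab pa pb = P.ι-∧ pab pa pb

      ∨-hom : ∀ {i a b} pab pa pb → merge i (a ∨ b) pab ~ merge i a pa ∨ₜ merge i b pb
      ∨-hom {zero}  pab pa pb = embed-by-value (rep pab) (rep pa Pₙ.∨ₜ rep pb)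
        (trans (ev pab) (sym (∨-cong (ev pa) (ev pb))))
      ∨-hom {suc _} pab pa pb = P.ι-∨ pab pa pb

      ¬-hom : ∀ {i a} pna pa → merge i (¬ a) pna ~ ¬ₜ (merge i a pa)
      ¬-hom {zero}  pna pa = embed-by-value (rep pna) (Pₙ.¬ₜ (rep pa))
        (trans (ev pna) (sym (¬-cong (ev pa))))
      ¬-hom {suc _} pna pa = P.ι-¬ pna pa

      ⊤-hom : ∀ {i} p → merge i ⊤ p ~ ⊤ₜ
      ⊤-hom {zero}  p = embed-by-value (rep p) Pₙ.⊤ₜ (ev p)
      ⊤-hom {suc _} p = P.ι-⊤ p

      ⊥-hom : ∀ {i} p → merge i ⊥ p ~ ⊥ₜ
      ⊥-hom {zero}  p = embed-by-value (rep p) Pₙ.⊥ₜ (ev p)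
      ⊥-hom {suc _} p = P.ι-⊥ p

      ideal-resp : ∀ {i j z} pi pj → merge i z pi ∧ₜ ¬ₜ (merge j z pj) ~ ⊥ₜ
      ideal-resp {zero}  {zero}  {z} pi pj =
        embed-by-value (rep pi Pₙ.∧ₜ Pₙ.¬ₜ (rep pj)) Pₙ.⊥ₜ
          (trans (∧-cong (ev pi) (¬-cong (ev pj))) (∧-complementʳ z))
      ideal-resp {zero}  {suc _} pi pj = ~⇒∧¬~⊥ (rep~gen pi pj)
      ideal-resp {suc _} {zero}  pi pj = ~⇒∧¬~⊥ (P.~-sym (rep~gen pj pi))
      ideal-resp {suc _} {suc _} pi pj = P.ideal pi pj

lemma3p34 : ∀ {c ℓ} (B : BooleanAlgebra c ℓ) (n : ℕ) (A : Fin (suc n) → Subset B) →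
    (∀ i → IsSubalgebra B (A i)) →
    Commutes B (A ∘ inject₁) →
    (A (fromℕ n) ∩ ⟨_⟩ B (⋃ B (A ∘ inject₁))) ≐ ⟨_⟩ B (A (fromℕ n) ∩ ⋃ B (A ∘ inject₁)) →
    Commutes B (pair B (⟨_⟩ B (⋃ B (A ∘ inject₁))) (A (fromℕ n))) →
    Commutes B A
lemma3p34 B n A sub Initial-commutes Last∩Generated≐ pair-commutes =
  retract-commutes B (split B A) (merge B A) (eval-split B A)
    (merge-preserves B A (sub (fromℕ n)) Initial-commutes (proj₁ Last∩Generated≐))
    (merge-split B A) pair-commutes
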